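{- Let $w$ be a string over $\{0,1\}$ with $\#w\ge 2$ such that $\xi(l^2(w))=\xi(r^2(w))\neq 0$. Then $\xi(m(w))\neq 0$.
   Context: $\#w$ is the length of $w$, $\varepsilon$ the empty string; for $\#w\ge1$, $l(w)$ is $w$ without its last letter and $r(w)$ is $w$ without its first letter; $l^2=l\circ l$, $r^2=r\circ r$, and for $\#w\ge2$, $m(w)=l(r(w))$. $T^n$ is the alternating string of length $n$ starting with $0$ ($T^0=\varepsilon$, $T^n=T^{n-1}0$ for odd $n$, $T^n=T^{n-1}1$ for even $n\ge2$) and $CT^n$ its letterwise complement. $\xi:\{0,1\}^*\to\{ -1,0,1\}$: $\xi(\varepsilon)=0$; $\xi(w)=1$ if $w=T^k$, $k\ge2$ even; $\xi(w)=-1$ if $w=CT^k$, $k\ge2$ even; otherwise $\xi(w)=\operatorname{sgn}(\xi(l(w))+\xi(r(w)))$. -}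

module Defs where

open import Data.Bool using (Bool; true; false; not; if_then_else_)
open import Data.Nat using (ℕ; zero; suc; _≥_; _≡ᵇ_)
open import Data.List using (List; []; _∷_; length; map; _∷ʳ_)
open import Data.List.Properties using (≡-dec)
open import Data.Integer using (ℤ; +_; -[1+_]; _+_; 0ℤ; 1ℤ; -1ℤ)
open import Data.Bool.Properties using () renaming (_≟_ to _≟ᵇ_)
open import Relation.Nullary using (does)

-- Binary strings: letter 0 is 'false', letter 1 is 'true'.
Word : Set
Word = List Bool

l : Word → Word
l [] = []
l (x ∷ []) = []
l (x ∷ y ∷ w) = x ∷ l (y ∷ w)

r : Word → Word
r [] = []
r (x ∷ w) = w

l² r² m : Word → Word
l² w = l (l w)
r² w = r (r w)
m w = l (r w)

evenᵇ : ℕ → Bool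
evenᵇ zero = true
evenᵇ (suc n) = not (evenᵇ n)

T : ℕ → Word
T zero = []
T (suc n) = T n ∷ʳ (if evenᵇ n then false else true)

CT : ℕ → Word
CT n = map not (T n)

sgn : ℤ → ℤ
sgn (+ zero) = 0ℤ
sgn (+ suc n) = 1ℤ
sgn -[1+ n ] = -1ℤ

_≟w_ : Word → Word → Bool
u ≟w v = does (≡-dec _≟ᵇ_ u v)

isEvenGe2 : ℕ → Bool
isEvenGe2 zero = false
isEvenGe2 (suc zero) = false
isEvenGe2 (suc (suc n)) = evenᵇ n

ξ-aux : ℕ → Word → ℤ
ξ-aux zero w = 0ℤ            -- only reached for w = ε
ξ-aux (suc n) w =
  if isEvenGe2 (length w) ∧' (w ≟w T (length w)) then 1ℤ
  else if isEvenGe2 (length w) ∧' (w ≟w CT (length w)) then -1ℤ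
  else sgn (ξ-aux n (l w) + ξ-aux n (r w))
  where
  _∧'_ : Bool → Bool → Bool
  true ∧' b = b
  false ∧' b = false

ξ : Word → ℤ
ξ w = ξ-aux (length w) w

module Submission where

-- The numbers ξ(u), for u ranging over the factors of w of a fixed length, form a row, and the
-- next row is computed from adjacent pairs by a local rule (a cellular automaton) once each
-- factor also records whether it equals T or CT of its length. By induction on the length,
-- every row is accepted by one of four finite automata over such cells (for factor length 1, 2,
-- odd ≥ 3 and even ≥ 4): this propagates from one length to the next through a simulation
-- relation between consecutive automata, verified exhaustively, as is the fact that no
-- accepted row contains three consecutive values a, 0, a with a ≠ 0. The factors l²w, m(w),
-- r²w are three consecutive entries of one row.

open import Defs
open import Data.Bool using (Bool; true; false; not; _∧_; if_then_else_)
open import Data.Bool.Properties using (_≟_; ∧-assoc; if-float; if-not; not-involutive)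
open import Data.Integer as ℤ using (ℤ; +_; -[1+_]; 0ℤ; 1ℤ; -1ℤ)
open import Data.List using (List; []; _∷_; [_]; _++_; foldl; length; map; take)
import Data.List.Membership.DecPropositional as DecMembership
open import Data.List.Membership.Propositional using (_∈_)
open import Data.List.Properties using (map-++; map-∘; map-cong; map-id; length-take; take-all)
open import Data.List.Relation.Unary.All as All using (All; all?)
open import Data.Nat using (ℕ; zero; suc; _+_; _≤_; _<_; _≥_; s≤s) renaming (_≟_ to _≟ℕ_)
open import Data.Nat.Properties using (≤-refl; n≤1+n; +-suc; m≤n⇒m⊓n≡m; m+n≤o⇒n≤o)
open import Data.Product using (_×_; _,_; proj₁; proj₂)
import Data.Product.Properties as Product
open import Function using (_∘_)
open import Relation.Binary.Definitions using (DecidableEquality)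
open import Relation.Binary.PropositionalEquality
  using (_≡_; _≢_; refl; sym; trans; cong; cong₂; subst; module ≡-Reasoning)
open import Relation.Nullary using (¬_; Dec; yes; no; does; ¬?; _×-dec_; _→-dec_)
open import Relation.Nullary.Decidable using (map′; from-yes)
open import Relation.Unary using (Decidable)

alternating : Bool → Word → Bool
alternating b []      = true
alternating b (x ∷ u) = does (x ≟ b) ∧ alternating (not b) u

alternating-l : ∀ b u → alternating b (l u) ∧ alternating b u ≡ alternating b u
alternating-l b []          = refl
alternating-l b (x ∷ [])    = refl
alternating-l b (x ∷ y ∷ u) = guarded (does (x ≟ b)) (alternating-l (not b) (y ∷ u))
  where
  guarded : ∀ d {a c} → a ∧ c ≡ c → (d ∧ a) ∧ (d ∧ c) ≡ d ∧ c
  guarded true  a∧c≡c = a∧c≡c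
  guarded false _     = refl

alternating-split : ∀ b x y w →
  alternating b (x ∷ y ∷ w) ≡ alternating b (l (x ∷ y ∷ w)) ∧ alternating (not b) (y ∷ w)
alternating-split b x y w = sym (begin
    (d ∧ alternating (not b) (l (y ∷ w))) ∧ alternating (not b) (y ∷ w)
  ≡⟨ ∧-assoc d _ _ ⟩
    d ∧ (alternating (not b) (l (y ∷ w)) ∧ alternating (not b) (y ∷ w))
  ≡⟨ cong (d ∧_) (alternating-l (not b) (y ∷ w)) ⟩
    d ∧ alternating (not b) (y ∷ w) ∎)
  where
  open ≡-Reasoning
  d = does (x ≟ b)

T-suc : ∀ n → T (suc n) ≡ false ∷ CT n
T-suc zero    = refl
T-suc (suc n) = begin
    T (suc n) ++ [ letter (suc n) ]
  ≡⟨ cong (_++ [ letter (suc n) ]) (T-suc n) ⟩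
    false ∷ (CT n ++ [ letter (suc n) ])
  ≡⟨ cong (λ b → false ∷ (CT n ++ [ b ])) letter-suc ⟩
    false ∷ (map not (T n) ++ map not [ letter n ])
  ≡⟨ cong (false ∷_) (sym (map-++ not (T n) [ letter n ])) ⟩
    false ∷ CT (suc n) ∎
  where
  open ≡-Reasoning
  letter : ℕ → Bool
  letter k = if evenᵇ k then false else true
  letter-suc : letter (suc n) ≡ not (letter n)
  letter-suc = trans (if-not (evenᵇ n)) (sym (if-float not (evenᵇ n)))

CT-suc : ∀ n → CT (suc n) ≡ true ∷ T n
CT-suc n = begin
    map not (T (suc n))            ≡⟨ cong (map not) (T-suc n) ⟩
    true ∷ map not (map not (T n)) ≡⟨ cong (true ∷_) (sym (map-∘ (T n))) ⟩
    true ∷ map (not ∘ not) (T n)   ≡⟨ cong (true ∷_) (map-cong not-involutive (T n)) ⟩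
    true ∷ map (λ b → b) (T n)     ≡⟨ cong (true ∷_) (map-id (T n)) ⟩
    true ∷ T n                     ∎
  where open ≡-Reasoning

≟w-T  : ∀ u → u ≟w T (length u) ≡ alternating false u
≟w-CT : ∀ u → u ≟w CT (length u) ≡ alternating true u
≟w-T []       = refl
≟w-T (x ∷ u)  = trans (cong ((x ∷ u) ≟w_) (T-suc (length u))) (cong (does (x ≟ false) ∧_) (≟w-CT u))
≟w-CT []      = refl
≟w-CT (x ∷ u) = trans (cong ((x ∷ u) ≟w_) (CT-suc (length u))) (cong (does (x ≟ true) ∧_) (≟w-T u))

data Trit : Set where
  neg zer pos : Trit

⟦_⟧ : Trit → ℤ
⟦ neg ⟧ = -1ℤ
⟦ zer ⟧ = 0ℤ
⟦ pos ⟧ = 1ℤ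

sign : ℤ → Trit
sign (+ zero)  = zer
sign (+ suc _) = pos
sign -[1+ _ ]  = neg

sign-⟦⟧ : ∀ t → sign ⟦ t ⟧ ≡ t
sign-⟦⟧ neg = refl
sign-⟦⟧ zer = refl
sign-⟦⟧ pos = refl

⟦⟧-injective : ∀ {s t} → ⟦ s ⟧ ≡ ⟦ t ⟧ → s ≡ t
⟦⟧-injective {s} {t} eq = trans (sym (sign-⟦⟧ s)) (trans (cong sign eq) (sign-⟦⟧ t))

infixl 6 _⊕_
_⊕_ : Trit → Trit → Trit
zer ⊕ t   = t
s   ⊕ zer = s
neg ⊕ neg = neg
pos ⊕ pos = pos
neg ⊕ pos = zer
pos ⊕ neg = zer

sgn-⟦⟧-+ : ∀ s t → sgn (⟦ s ⟧ ℤ.+ ⟦ t ⟧) ≡ ⟦ s ⊕ t ⟧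
sgn-⟦⟧-+ neg neg = refl
sgn-⟦⟧-+ neg zer = refl
sgn-⟦⟧-+ neg pos = refl
sgn-⟦⟧-+ zer neg = refl
sgn-⟦⟧-+ zer zer = refl
sgn-⟦⟧-+ zer pos = refl
sgn-⟦⟧-+ pos neg = refl
sgn-⟦⟧-+ pos zer = refl
sgn-⟦⟧-+ pos pos = refl

choose : {A : Set} → Bool → Bool → A → A → A → A
choose t c x y z = if t then x else if c then y else z

choose-float : ∀ {A B : Set} (f : A → B) t c {x y z : A} →
               f (choose t c x y z) ≡ choose t c (f x) (f y) (f z)
choose-float f true  c     = refl
choose-float f false true  = refl
choose-float f false false = refl

τ-aux : ℕ → Word → Trit
τ-aux zero    w = zer
τ-aux (suc n) w =
  choose (isEvenGe2 (length w) ∧ alternating false w) (isEvenGe2 (length w) ∧ alternating true w)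
         pos neg (τ-aux n (l w) ⊕ τ-aux n (r w))

τ : Word → Trit
τ w = τ-aux (length w) w

ξ-aux-suc : ∀ n w →
  ξ-aux (suc n) w ≡
  choose (isEvenGe2 (length w) ∧ (w ≟w T (length w))) (isEvenGe2 (length w) ∧ (w ≟w CT (length w)))
         1ℤ -1ℤ (sgn (ξ-aux n (l w) ℤ.+ ξ-aux n (r w)))
ξ-aux-suc n w with isEvenGe2 (length w)
... | true  = refl
... | false = refl

ξ-aux-τ : ∀ n w → ξ-aux n w ≡ ⟦ τ-aux n w ⟧
ξ-aux-τ zero    w = refl
ξ-aux-τ (suc n) w = begin
    ξ-aux (suc n) w
  ≡⟨ ξ-aux-suc n w ⟩
    choose (e ∧ (w ≟w T (length w))) (e ∧ (w ≟w CT (length w))) 1ℤ -1ℤ (sgn (ξ-aux n (l w) ℤ.+ ξ-aux n (r w)))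
  ≡⟨ cong₂ (λ t c → choose (e ∧ t) (e ∧ c) 1ℤ -1ℤ (sgn (ξ-aux n (l w) ℤ.+ ξ-aux n (r w)))) (≟w-T w) (≟w-CT w) ⟩
    choose t₀ t₁ 1ℤ -1ℤ (sgn (ξ-aux n (l w) ℤ.+ ξ-aux n (r w)))
  ≡⟨ cong (choose t₀ t₁ 1ℤ -1ℤ) (cong₂ (λ a b → sgn (a ℤ.+ b)) (ξ-aux-τ n (l w)) (ξ-aux-τ n (r w))) ⟩
    choose t₀ t₁ 1ℤ -1ℤ (sgn (⟦ τ-aux n (l w) ⟧ ℤ.+ ⟦ τ-aux n (r w) ⟧))
  ≡⟨ cong (choose t₀ t₁ 1ℤ -1ℤ) (sgn-⟦⟧-+ (τ-aux n (l w)) (τ-aux n (r w))) ⟩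
    choose t₀ t₁ ⟦ pos ⟧ ⟦ neg ⟧ ⟦ τ-aux n (l w) ⊕ τ-aux n (r w) ⟧
  ≡⟨ choose-float ⟦_⟧ t₀ t₁ ⟨
    ⟦ τ-aux (suc n) w ⟧ ∎
  where
  open ≡-Reasoning
  e = isEvenGe2 (length w)
  t₀ = e ∧ alternating false w
  t₁ = e ∧ alternating true w

ξ≡⟦τ⟧ : ∀ w → ξ w ≡ ⟦ τ w ⟧
ξ≡⟦τ⟧ w = ξ-aux-τ (length w) w

record Cell : Set where
  constructor cell
  field
    value : Trit
    isT   : Bool
    isCT  : Bool

open Cell

cellOf : Word → Cell
cellOf u = cell (τ u) (alternating false u) (alternating true u)

-- The Bool says whether the combined word has even length.
combine : Bool → Cell → Cell → Cell
combine e (cell a ta ca) (cell b tb cb) = cell (choose (e ∧ t) (e ∧ c) pos neg (a ⊕ b)) t c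
  where
  t = ta ∧ cb
  c = ca ∧ tb

length-l : ∀ x u → length (l (x ∷ u)) ≡ length u
length-l x []      = refl
length-l x (y ∷ u) = cong suc (length-l y u)

cellOf-step : ∀ x y w →
  cellOf (x ∷ y ∷ w) ≡ combine (evenᵇ (length w)) (cellOf (l (x ∷ y ∷ w))) (cellOf (y ∷ w))
cellOf-step x y w =
  trans (cong (shape _ _) (cong (λ n → τ-aux (suc n) (l u)) (sym (length-l y w))))
        (cong₂ (λ t c → shape t c (τ (l u))) (alternating-split false x y w) (alternating-split true x y w))
  where
  u = x ∷ y ∷ w
  shape : Bool → Bool → Trit → Cell
  shape t c a = cell (choose (evenᵇ (length w) ∧ t) (evenᵇ (length w) ∧ c) pos neg (a ⊕ τ (y ∷ w))) t c

windows : ℕ → ℕ → Word → List Word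
windows k zero    w = []
windows k (suc j) w = take k w ∷ windows k j (r w)

row : ℕ → ℕ → Word → List Cell
row k j w = map cellOf (windows k j w)

step : Bool → List Cell → List Cell
step e (a ∷ b ∷ X) = combine e a b ∷ step e (b ∷ X)
step e _           = []

l-cons : ∀ x u → l (x ∷ u) ≡ take (length u) (x ∷ u)
l-cons x []      = refl
l-cons x (y ∷ u) = cong (x ∷_) (l-cons y u)

l-take : ∀ n w → n < length w → l (take (suc n) w) ≡ take n w
l-take zero    (x ∷ w)     _       = refl
l-take (suc n) (x ∷ y ∷ w) (s≤s h) = cong (x ∷_) (l-take n (y ∷ w) h)

cellOf-take : ∀ k w → suc (suc k) ≤ length w →
  cellOf (take (suc (suc k)) w) ≡ combine (evenᵇ k) (cellOf (take (suc k) w)) (cellOf (take (suc k) (r w)))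
cellOf-take k w@(x ∷ y ∷ v) h@(s≤s (s≤s k≤v)) = begin
    cellOf (x ∷ y ∷ take k v)
  ≡⟨ cellOf-step x y (take k v) ⟩
    combine (evenᵇ (length (take k v))) (cellOf (l (x ∷ y ∷ take k v))) (cellOf (y ∷ take k v))
  ≡⟨ cong₂ (λ n u → combine (evenᵇ n) (cellOf u) (cellOf (y ∷ take k v)))
           (trans (length-take k v) (m≤n⇒m⊓n≡m k≤v)) (l-take (suc k) w h) ⟩
    combine (evenᵇ k) (cellOf (take (suc k) w)) (cellOf (y ∷ take k v)) ∎
  where open ≡-Reasoning

step-row : ∀ k j w → j + suc k ≤ length w →
  step (evenᵇ k) (row (suc k) (suc j) w) ≡ row (suc (suc k)) j w
step-row k zero    w       _       = refl
step-row k (suc j) (x ∷ w) (s≤s h) =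
  cong₂ _∷_ (sym (cellOf-take k (x ∷ w) (s≤s (m+n≤o⇒n≤o j h)))) (step-row k j w h)

data Stage : Set where
  len1 len2 lenOdd lenEven : Stage

next : Stage → Stage
next len1    = len2
next len2    = lenOdd
next lenOdd  = lenEven
next lenEven = lenOdd

-- stage k is the stage of the factors of length suc k.
stage : ℕ → Stage
stage zero    = len1
stage (suc k) = next (stage k)

evenLength : Stage → Bool
evenLength len1    = false
evenLength len2    = true
evenLength lenOdd  = false
evenLength lenEven = true

evenLength-stage : ∀ k → evenLength (stage (suc k)) ≡ evenᵇ k
evenLength-stage zero    = refl
evenLength-stage (suc k) = trans (evenLength-next (stage (suc k))) (cong not (evenLength-stage k))
  where
  evenLength-next : ∀ s → evenLength (next s) ≡ not (evenLength s)
  evenLength-next len1    = refl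
  evenLength-next len2    = refl
  evenLength-next lenOdd  = refl
  evenLength-next lenEven = refl

-- Transition functions of automata over cells, one per stage, found by computer search.
-- States are numbered from 1; 0 is the dead state.
δ : Stage → ℕ → Cell → ℕ
δ len1 1 (cell zer false true)      = 1
δ len1 1 (cell zer true false)      = 1
δ len2 1 (cell neg false true)      = 2
δ len2 1 (cell zer false false)     = 1
δ len2 1 (cell pos true false)      = 3
δ len2 2 (cell zer false false)     = 2
δ len2 2 (cell pos true false)      = 3
δ len2 3 (cell neg false true)      = 2
δ len2 3 (cell zer false false)     = 3
δ lenOdd 1 (cell neg false false)   = 2
δ lenOdd 1 (cell zer false false)   = 3
δ lenOdd 1 (cell zer false true)    = 5
δ lenOdd 1 (cell zer true false)    = 4
δ lenOdd 1 (cell pos false false)   = 6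
δ lenOdd 10 (cell neg false false)  = 11
δ lenOdd 10 (cell zer false false)  = 12
δ lenOdd 10 (cell pos false false)  = 6
δ lenOdd 11 (cell neg false false)  = 2
δ lenOdd 11 (cell zer false false)  = 7
δ lenOdd 11 (cell zer false true)   = 5
δ lenOdd 12 (cell neg false false)  = 2
δ lenOdd 12 (cell zer false false)  = 12
δ lenOdd 2 (cell neg false false)   = 2
δ lenOdd 2 (cell zer false false)   = 7
δ lenOdd 2 (cell zer false true)    = 5
δ lenOdd 2 (cell pos false false)   = 8
δ lenOdd 3 (cell neg false false)   = 2
δ lenOdd 3 (cell zer false false)   = 3
δ lenOdd 3 (cell pos false false)   = 6
δ lenOdd 4 (cell neg false false)   = 9
δ lenOdd 4 (cell zer false true)    = 5
δ lenOdd 5 (cell zer true false)    = 4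
δ lenOdd 5 (cell pos false false)   = 10
δ lenOdd 6 (cell neg false false)   = 11
δ lenOdd 6 (cell zer false false)   = 12
δ lenOdd 6 (cell zer true false)    = 4
δ lenOdd 6 (cell pos false false)   = 6
δ lenOdd 7 (cell zer false false)   = 7
δ lenOdd 7 (cell pos false false)   = 6
δ lenOdd 8 (cell zer false false)   = 12
δ lenOdd 8 (cell zer true false)    = 4
δ lenOdd 8 (cell pos false false)   = 6
δ lenOdd 9 (cell neg false false)   = 2
δ lenOdd 9 (cell zer false false)   = 7
δ lenOdd 9 (cell pos false false)   = 8
δ lenEven 1 (cell neg false false)  = 2
δ lenEven 1 (cell neg false true)   = 3
δ lenEven 1 (cell zer false false)  = 4
δ lenEven 1 (cell pos false false)  = 5
δ lenEven 1 (cell pos true false)   = 6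
δ lenEven 10 (cell neg false false) = 2
δ lenEven 10 (cell zer false false) = 10
δ lenEven 2 (cell neg false false)  = 2
δ lenEven 2 (cell neg false true)   = 3
δ lenEven 2 (cell zer false false)  = 7
δ lenEven 2 (cell pos false false)  = 8
δ lenEven 3 (cell neg false false)  = 9
δ lenEven 3 (cell pos true false)   = 6
δ lenEven 4 (cell neg false false)  = 2
δ lenEven 4 (cell zer false false)  = 4
δ lenEven 4 (cell pos false false)  = 5
δ lenEven 5 (cell neg false false)  = 9
δ lenEven 5 (cell zer false false)  = 10
δ lenEven 5 (cell pos false false)  = 5
δ lenEven 5 (cell pos true false)   = 6
δ lenEven 6 (cell neg false true)   = 3
δ lenEven 6 (cell pos false false)  = 8
δ lenEven 7 (cell zer false false)  = 7
δ lenEven 7 (cell pos false false)  = 5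
δ lenEven 8 (cell zer false false)  = 10
δ lenEven 8 (cell pos false false)  = 5
δ lenEven 9 (cell neg false false)  = 2
δ lenEven 9 (cell zer false false)  = 7
δ _ _ _                             = 0

Accepts : Stage → ℕ → List Cell → Set
Accepts s q X = foldl (δ s) q X ≢ 0

dead-absorbing : ∀ s X → foldl (δ s) 0 X ≡ 0
dead-absorbing s []      = refl
dead-absorbing s (b ∷ X) = trans (cong (λ q → foldl (δ s) q X) (δ-dead s b)) (dead-absorbing s X)
  where
  δ-dead : ∀ s b → δ s 0 b ≡ 0
  δ-dead len1    b = refl
  δ-dead len2    b = refl
  δ-dead lenOdd  b = refl
  δ-dead lenEven b = refl

Accepts-live : ∀ s {q} X → Accepts s q X → q ≢ 0
Accepts-live s X acc refl = acc (dead-absorbing s X)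

-- A triple (p , a , q) relates a state p of the automaton of stage s that has just read the cell a
-- to a state q of the automaton of the next stage.
simulation : Stage → List (ℕ × Cell × ℕ)
simulation len1 =
  (1 , cell zer false true , 1) ∷ (1 , cell zer false true , 3) ∷ (1 , cell zer true false , 1) ∷
  (1 , cell zer true false , 2) ∷ []
simulation len2 =
  (1 , cell zer false false , 1) ∷ (1 , cell zer false false , 3) ∷ (2 , cell neg false true , 1) ∷
  (2 , cell neg false true , 2) ∷ (2 , cell neg false true , 4) ∷ (2 , cell neg false true , 11) ∷
  (2 , cell zer false false , 2) ∷ (2 , cell zer false false , 7) ∷ (2 , cell zer false false , 9) ∷
  (3 , cell zer false false , 6) ∷ (3 , cell zer false false , 10) ∷ (3 , cell zer false false , 12) ∷
  (3 , cell pos true false , 1) ∷ (3 , cell pos true false , 5) ∷ (3 , cell pos true false , 6) ∷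
  (3 , cell pos true false , 8) ∷ []
simulation lenOdd =
  (2 , cell neg false false , 1) ∷ (2 , cell neg false false , 2) ∷ (2 , cell neg false false , 9) ∷
  (3 , cell zer false false , 1) ∷ (3 , cell zer false false , 4) ∷ (4 , cell zer true false , 1) ∷
  (4 , cell zer true false , 3) ∷ (4 , cell zer true false , 5) ∷ (5 , cell zer false true , 1) ∷
  (5 , cell zer false true , 2) ∷ (5 , cell zer false true , 6) ∷ (6 , cell pos false false , 1) ∷
  (6 , cell pos false false , 5) ∷ (6 , cell pos false false , 8) ∷ (7 , cell zer false false , 2) ∷
  (7 , cell zer false false , 7) ∷ (8 , cell pos false false , 4) ∷ (8 , cell pos false false , 7) ∷
  (9 , cell neg false false , 2) ∷ (9 , cell neg false false , 9) ∷ (10 , cell pos false false , 5) ∷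
  (10 , cell pos false false , 8) ∷ (11 , cell neg false false , 4) ∷ (11 , cell neg false false , 10) ∷
  (12 , cell zer false false , 5) ∷ (12 , cell zer false false , 10) ∷ []
simulation lenEven =
  (2 , cell neg false false , 1) ∷ (2 , cell neg false false , 2) ∷ (2 , cell neg false false , 11) ∷
  (3 , cell neg false true , 1) ∷ (3 , cell neg false true , 2) ∷ (3 , cell neg false true , 4) ∷
  (4 , cell zer false false , 1) ∷ (4 , cell zer false false , 3) ∷ (5 , cell pos false false , 1) ∷
  (5 , cell pos false false , 6) ∷ (5 , cell pos false false , 8) ∷ (6 , cell pos true false , 1) ∷
  (6 , cell pos true false , 5) ∷ (6 , cell pos true false , 6) ∷ (7 , cell zer false false , 2) ∷
  (7 , cell zer false false , 7) ∷ (8 , cell pos false false , 3) ∷ (8 , cell pos false false , 6) ∷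
  (8 , cell pos false false , 7) ∷ (8 , cell pos false false , 10) ∷ (9 , cell neg false false , 2) ∷
  (9 , cell neg false false , 3) ∷ (9 , cell neg false false , 9) ∷ (9 , cell neg false false , 12) ∷
  (10 , cell zer false false , 6) ∷ (10 , cell zer false false , 12) ∷ []

SimulationStep : Stage → ℕ × Cell × ℕ → Set
SimulationStep s (p , a , q) =
  q ≢ 0 × (∀ b → δ s p b ≢ 0 → (δ s p b , b , δ (next s) q (combine (evenLength (next s)) a b)) ∈ simulation s)

SimulationStarts : Stage → Set
SimulationStarts s = ∀ a → δ s 1 a ≢ 0 → (δ s 1 a , a , 1) ∈ simulation s

SimulationCloses : Stage → Set
SimulationCloses s = All (SimulationStep s) (simulation s)

Forbidden : Cell → Cell → Cell → Set
Forbidden x y z = value x ≡ value z × value x ≢ zer × value y ≡ zer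

AvoidsForbidden : Stage → Set
AvoidsForbidden s = ∀ x y z → Accepts s 1 (x ∷ y ∷ z ∷ []) → ¬ Forbidden x y z

Certified : Stage → Set
Certified s = SimulationStarts s × SimulationCloses s × AvoidsForbidden s

_≟ᵗ_ : DecidableEquality Trit
neg ≟ᵗ neg = yes refl
neg ≟ᵗ zer = no λ ()
neg ≟ᵗ pos = no λ ()
zer ≟ᵗ neg = no λ ()
zer ≟ᵗ zer = yes refl
zer ≟ᵗ pos = no λ ()
pos ≟ᵗ neg = no λ ()
pos ≟ᵗ zer = no λ ()
pos ≟ᵗ pos = yes refl

_≟ᶜ_ : DecidableEquality Cell
cell a t c ≟ᶜ cell a′ t′ c′ =
  map′ (λ { (refl , refl , refl) → refl }) (λ { refl → refl , refl , refl }) (a ≟ᵗ a′ ×-dec t ≟ t′ ×-dec c ≟ c′)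

open DecMembership (Product.≡-dec _≟ℕ_ (Product.≡-dec _≟ᶜ_ _≟ℕ_)) using (_∈?_)

∀-Bool? : {P : Bool → Set} → Decidable P → Dec (∀ b → P b)
∀-Bool? P? = map′ (λ (f , t) → λ { false → f ; true → t }) (λ h → h false , h true) (P? false ×-dec P? true)

∀-Trit? : {P : Trit → Set} → Decidable P → Dec (∀ a → P a)
∀-Trit? P? =
  map′ (λ (n , z , p) → λ { neg → n ; zer → z ; pos → p }) (λ h → h neg , h zer , h pos)
       (P? neg ×-dec P? zer ×-dec P? pos)

∀-Cell? : {P : Cell → Set} → Decidable P → Dec (∀ x → P x)
∀-Cell? P? =
  map′ (λ h x → h (value x) (isT x) (isCT x)) (λ h a t c → h (cell a t c))
       (∀-Trit? λ a → ∀-Bool? λ t → ∀-Bool? λ c → P? (cell a t c))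

certified? : ∀ s → Dec (Certified s)
certified? s = starts? ×-dec all? closes? (simulation s) ×-dec avoids?
  where
  accepts? : ∀ X → Dec (Accepts s 1 X)
  accepts? X = ¬? (foldl (δ s) 1 X ≟ℕ 0)
  starts? = ∀-Cell? λ a → ¬? (δ s 1 a ≟ℕ 0) →-dec ((δ s 1 a , a , 1) ∈? simulation s)
  closes? : Decidable (SimulationStep s)
  closes? (p , a , q) =
    ¬? (q ≟ℕ 0) ×-dec ∀-Cell? λ b → ¬? (δ s p b ≟ℕ 0) →-dec
      ((δ s p b , b , δ (next s) q (combine (evenLength (next s)) a b)) ∈? simulation s)
  forbidden? : ∀ x y z → Dec (Forbidden x y z)
  forbidden? x y z = value x ≟ᵗ value z ×-dec ¬? (value x ≟ᵗ zer) ×-dec value y ≟ᵗ zer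
  avoids? = ∀-Cell? λ x → ∀-Cell? λ y → ∀-Cell? λ z → accepts? (x ∷ y ∷ z ∷ []) →-dec ¬? (forbidden? x y z)

certified : ∀ s → Certified s
certified len1    = from-yes (certified? len1)
certified len2    = from-yes (certified? len2)
certified lenOdd  = from-yes (certified? lenOdd)
certified lenEven = from-yes (certified? lenEven)

simulation-starts : ∀ s → SimulationStarts s
simulation-starts s = proj₁ (certified s)

simulation-closes : ∀ s → SimulationCloses s
simulation-closes s = proj₁ (proj₂ (certified s))

avoids-forbidden : ∀ s → AvoidsForbidden s
avoids-forbidden s = proj₂ (proj₂ (certified s))

simulate : ∀ s X {p a q} → (p , a , q) ∈ simulation s → Accepts s p X →
           Accepts (next s) q (step (evenLength (next s)) (a ∷ X))
simulate s []      paq _   = proj₁ (All.lookup (simulation-closes s) paq)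
simulate s (b ∷ X) paq acc =
  simulate s X (proj₂ (All.lookup (simulation-closes s) paq) b (Accepts-live s X acc)) acc

accepts-step : ∀ s X → Accepts s 1 X → Accepts (next s) 1 (step (evenLength (next s)) X)
accepts-step s []      _   = λ ()
accepts-step s (a ∷ X) acc = simulate s X (simulation-starts s a (Accepts-live s X acc)) acc

letter-rows-accepted : ∀ j w → j + 1 ≤ length w → Accepts len1 1 (row 1 (suc j) w)
letter-rows-accepted zero    (false ∷ w) _       = λ ()
letter-rows-accepted zero    (true ∷ w)  _       = λ ()
letter-rows-accepted (suc j) (false ∷ w) (s≤s h) = letter-rows-accepted j w h
letter-rows-accepted (suc j) (true ∷ w)  (s≤s h) = letter-rows-accepted j w h

rows-accepted : ∀ k j w → j + suc k ≤ length w → Accepts (stage k) 1 (row (suc k) (suc j) w)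
rows-accepted zero    j w h = letter-rows-accepted j w h
rows-accepted (suc k) j w h =
  subst (Accepts (stage (suc k)) 1) next-row
        (accepts-step (stage k) (row (suc k) (suc (suc j)) w) (rows-accepted k (suc j) w h′))
  where
  h′ : suc j + suc k ≤ length w
  h′ = subst (_≤ length w) (+-suc j (suc k)) h
  next-row : step (evenLength (stage (suc k))) (row (suc k) (suc (suc j)) w) ≡ row (suc (suc k)) (suc j) w
  next-row = trans (cong (λ e → step e (row (suc k) (suc (suc j)) w)) (evenLength-stage k))
                   (step-row k (suc j) w h′)

inner-factors-accepted : ∀ x y z v → let w = x ∷ y ∷ z ∷ v in
  Accepts (stage (length v)) 1 (cellOf (l² w) ∷ cellOf (m w) ∷ cellOf (r² w) ∷ [])
inner-factors-accepted x y z v = subst (Accepts (stage k) 1) factors (rows-accepted k 2 w ≤-refl)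
  where
  k = length v
  w = x ∷ y ∷ z ∷ v
  l²≡take : l² w ≡ take (suc k) w
  l²≡take = trans (cong l (l-cons x (y ∷ z ∷ v))) (l-take (suc k) w (n≤1+n _))
  factors : row (suc k) 3 w ≡ cellOf (l² w) ∷ cellOf (m w) ∷ cellOf (r² w) ∷ []
  factors = cong₃ (λ u u′ u″ → cellOf u ∷ cellOf u′ ∷ cellOf u″ ∷ [])
                  (sym l²≡take) (sym (l-cons y (z ∷ v))) (take-all (suc k) (z ∷ v) ≤-refl)
    where
    cong₃ : ∀ {A B : Set} (f : A → A → A → B) {a a′ b b′ c c′} → a ≡ a′ → b ≡ b′ → c ≡ c′ → f a b c ≡ f a′ b′ c′
    cong₃ f refl refl refl = refl

theorem2p14 : (w : Word) → length w ≥ 2 → ξ (l² w) ≡ ξ (r² w) → ξ (l² w) ≢ 0ℤ → ξ (m w) ≢ 0ℤ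
theorem2p14 []              ()
theorem2p14 (x ∷ [])        (s≤s ())
theorem2p14 (x ∷ y ∷ [])    _ _ l²≢0 _ = l²≢0 refl
theorem2p14 (x ∷ y ∷ z ∷ v) _ l²≡r² l²≢0 m≡0 =
  avoids-forbidden (stage (length v)) _ _ _ (inner-factors-accepted x y z v)
    (⟦⟧-injective (trans (sym (ξ≡⟦τ⟧ (l² w))) (trans l²≡r² (ξ≡⟦τ⟧ (r² w))))
    , (λ τ≡zer → l²≢0 (trans (ξ≡⟦τ⟧ (l² w)) (cong ⟦_⟧ τ≡zer)))
    , ⟦⟧-injective (trans (sym (ξ≡⟦τ⟧ (m w))) m≡0))
  where
  w = x ∷ y ∷ z ∷ v
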